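{- Let $d$ be a positive square-free integer, $K=\mathbb{Q}(\sqrt{ -d})$, $p$ a prime, and $(A,B,C)$ integers with $A^4+dB^2=C^p$ and $\gcd(A,B,C)=1$. Let $E=E_{(A,B)}$. Let $q$ be an odd rational prime ramified in $K/\mathbb{Q}$ and $\mathfrak{q}$ the unique prime of $K$ above $q$. Then $\mathfrak{q}\nmid\Delta(E)$.
   Context: Let $r\in K$ with $r^2=-d$. $E_{(A,B)}$ is the elliptic curve over $K$ given by $y^2=x^3+4Ax^2+2(A^2+rB)x$, with discriminant $\Delta(E)=512(A^2+rB)C^p$. -}

module Defs where

open import Data.Nat as ℕ using (ℕ; _%_)
open import Data.Nat.Primality using (Prime)
import Data.Nat.Divisibility as ℕD
open import Data.Integer as ℤ using (ℤ; +_; -_; _+_; _*_; _-_; _^_)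
open import Data.Integer.Divisibility using (_∣_)
open import Data.Integer.GCD using (gcd)
open import Data.Product using (_×_; Σ; ∃; _,_)
open import Relation.Binary.PropositionalEquality using (_≡_)

SquareFree : ℕ → Set
SquareFree d = ∀ (n : ℕ) → (n ℕ.* n) ℕD.∣ d → n ≡ 1

-- Elements of K = ℚ(√-d) with coordinates (a , b) representing (a + b·r)/2,
-- where r = √-d (r² = -d).  Every element of O_K has this shape.
Half : Set
Half = ℤ × ℤ

-- Ring of integers O_K of K = ℚ(√-d), d > 0 square-free:
--   if -d ≡ 1 (mod 4), i.e. d % 4 = 3, O_K = ℤ[(1+r)/2] = {(a+br)/2 : a ≡ b mod 2};
--   otherwise O_K = ℤ[r] = {(a+br)/2 : a, b even}.
InOK : ℕ → Half → Set
InOK d (a , b) with d % 4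
... | 3 = (+ 2) ∣ (a - b)
... | _ = ((+ 2) ∣ a) × ((+ 2) ∣ b)

discK : ℕ → ℤ
discK d with d % 4
... | 3 = - (+ d)
... | _ = - (+ (4 ℕ.* d))

Ramified : ℕ → ℕ → Set
Ramified d q = (+ q) ∣ discK d

-- The prime ideal 𝔮 = q·O_K + r·O_K of O_K above an odd ramified prime q
-- (its unique prime above q: q·O_K = 𝔮²).  Divisibility 𝔮 ∣ x of an element x of
-- O_K means x ∈ 𝔮, i.e. x = q·α + r·β with α, β ∈ O_K.
-- In half-coordinates: q·(a,b) = (q a, q b),  r·(a,b) = (-d b, a).
PrimeAboveDivides : (d q : ℕ) → Half → Set
PrimeAboveDivides d q (x , y) =
  Σ Half λ α → Σ Half λ β →
    InOK d α × InOK d β ×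
    (let (a₁ , b₁) = α ; (a₂ , b₂) = β in
      (x ≡ (+ q) * a₁ - (+ d) * b₂) × (y ≡ (+ q) * b₁ + a₂))

-- Δ(E_{(A,B)}) = 512 (A² + r B) C^p ∈ O_K, in half-coordinates.
discE : (p : ℕ) → (A B C : ℤ) → Half
discE p A B C =
  ( (+ 2) * ((+ 512) * (A ^ 2) * (C ^ p))
  , (+ 2) * ((+ 512) * B * (C ^ p)) )

{-# OPTIONS --safe #-}
module Submission where

-- An odd prime q ramified in K divides d, so every element qα + rβ of 𝔮 has
-- first half-coordinate divisible by q; hence 𝔮 ∣ Δ(E) forces q ∣ 2¹⁰ A² Cᵖ,
-- i.e. q ∣ A or q ∣ C.  Because q ∣ d, the equation A⁴ + dB² = Cᵖ
-- makes q divide both A and C; then q² divides A⁴ and Cᵖ (p ≥ 2), hence q² ∣ dB²,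
-- and square-freeness of d leaves q ∣ B, contradicting gcd(A, B, C) = 1.

open import Defs
open import Data.Empty using (⊥-elim)
open import Data.Integer as ℤ using (ℤ; +_; -_; _+_; _*_; _^_)
open import Data.Integer.Divisibility.Signed
open import Data.Integer.GCD using (gcd; gcd-greatest)
import Data.Integer.Properties as ℤP
open import Data.Integer.Tactic.RingSolver using (solve-∀)
open import Data.Nat as ℕ using (ℕ; _%_; zero; suc; _≤_; z≤n; s≤s)
import Data.Nat.Divisibility as ℕD
open import Data.Nat.Primality
  using (Prime; euclidsLemma; prime[2]; prime⇒irreducible; prime⇒nonZero; prime⇒nonTrivial; ¬prime[1])
import Data.Nat.Properties as ℕP
open import Data.Product using (_×_; _,_; proj₁; proj₂)
open import Data.Sum using (_⊎_; inj₁; inj₂; [_,_]′)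
open import Function using (_∘_; id)
open import Relation.Binary.PropositionalEquality using (_≡_; refl; sym; cong; subst; module ≡-Reasoning)
open import Relation.Nullary using (¬_)

private
  variable
    d e p q : ℕ
    i j A B C : ℤ

prime∤1 : Prime q → ¬ (+ q ∣ + 1)
prime∤1 q-prime q∣1 = ¬prime[1] (subst Prime (ℕD.∣1⇒≡1 (∣⇒∣ᵤ q∣1)) q-prime)

prime∣*⇒∣⊎∣ : Prime q → + q ∣ i * j → + q ∣ i ⊎ + q ∣ j
prime∣*⇒∣⊎∣ {i = i} {j} q-prime q∣ij
  with euclidsLemma ℤ.∣ i ∣ ℤ.∣ j ∣ q-prime (subst (_ ℕD.∣_) (ℤP.abs-* i j) (∣⇒∣ᵤ q∣ij))
... | inj₁ q∣i = inj₁ (∣ᵤ⇒∣ q∣i)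
... | inj₂ q∣j = inj₂ (∣ᵤ⇒∣ q∣j)

prime∣^⇒∣ : Prime q → ∀ n → + q ∣ i ^ n → + q ∣ i
prime∣^⇒∣ q-prime zero    q∣1 = ⊥-elim (prime∤1 q-prime q∣1)
prime∣^⇒∣ q-prime (suc n) q∣iⁿ⁺¹ with prime∣*⇒∣⊎∣ q-prime q∣iⁿ⁺¹
... | inj₁ q∣i  = q∣i
... | inj₂ q∣iⁿ = prime∣^⇒∣ q-prime n q∣iⁿ

oddPrime∤2 : Prime q → q % 2 ≡ 1 → ¬ (+ q ∣ + 2)
oddPrime∤2 q-prime q-odd q∣2 with prime⇒irreducible prime[2] (∣⇒∣ᵤ q∣2)
oddPrime∤2 q-prime q-odd q∣2 | inj₁ refl = ¬prime[1] q-prime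
oddPrime∤2 q-prime ()    q∣2 | inj₂ refl

oddPrime∤2^ : Prime q → q % 2 ≡ 1 → ∀ n → ¬ (+ q ∣ (+ 2) ^ n)
oddPrime∤2^ q-prime q-odd n = oddPrime∤2 q-prime q-odd ∘ prime∣^⇒∣ q-prime n

∣-n∣∣ : ∀ n {m} → n ℕD.∣ m → ℤ.∣ - + n ∣ ℕD.∣ m
∣-n∣∣ n = subst (ℕD._∣ _) (sym (ℤP.∣-i∣≡∣i∣ (+ n)))

∣discK∣∣4d : ∀ d → ℤ.∣ discK d ∣ ℕD.∣ 4 ℕ.* d
∣discK∣∣4d d with d % 4
... | 0 = ∣-n∣∣ (4 ℕ.* d) ℕD.∣-refl
... | 1 = ∣-n∣∣ (4 ℕ.* d) ℕD.∣-refl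
... | 2 = ∣-n∣∣ (4 ℕ.* d) ℕD.∣-refl
... | 3 = ∣-n∣∣ d (ℕD.n∣m*n 4)
... | suc (suc (suc (suc _))) = ∣-n∣∣ (4 ℕ.* d) ℕD.∣-refl

oddRamified⇒∣ : Prime q → q % 2 ≡ 1 → Ramified d q → q ℕD.∣ d
oddRamified⇒∣ {q} {d} q-prime q-odd q-ramified
  with euclidsLemma 4 d q-prime (ℕD.∣-trans q-ramified (∣discK∣∣4d d))
... | inj₁ q∣4 = ⊥-elim (oddPrime∤2^ q-prime q-odd 2 (∣ᵤ⇒∣ q∣4))
... | inj₂ q∣d = q∣d

primeAboveDivides⇒∣₁ : ∀ {x y} → q ℕD.∣ d → PrimeAboveDivides d q (x , y) → + q ∣ x
primeAboveDivides⇒∣₁ q∣d ((a₁ , _) , (_ , b₂) , _ , _ , refl , _) =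
  ∣m∣n⇒∣m-n (∣m⇒∣m*n a₁ ∣-refl) (∣m⇒∣m*n {m = + _} b₂ (∣ᵤ⇒∣ q∣d))

∣⇒∣^ : ∀ {k n} → k ∣ i → 1 ≤ n → k ∣ i ^ n
∣⇒∣^ k∣i (s≤s _) = ∣m⇒∣m*n _ k∣i

∣⇒²∣^ : ∀ {k n} → k ∣ i → 2 ≤ n → k * k ∣ i ^ n
∣⇒²∣^ {k = k} (divides c refl) (s≤s (s≤s {n = m} _)) =
  divides (c * c * (c * k) ^ m) (regroup c k ((c * k) ^ m))
  where
  regroup : ∀ c k W → c * k * (c * k * W) ≡ c * c * W * (k * k)
  regroup = solve-∀

squareFree⇒prime∤cofactor : Prime q → SquareFree (e ℕ.* q) → ¬ q ℕD.∣ e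
squareFree⇒prime∤cofactor {q} q-prime e*q-squarefree (ℕD.divides f refl) =
  ¬prime[1] (subst Prime (e*q-squarefree q (ℕD.divides f (ℕP.*-assoc f q q))) q-prime)

prime∣cofactor*²⇒∣ : Prime q → SquareFree (e ℕ.* q) → + q ∣ + e * i ^ 2 → + q ∣ i
prime∣cofactor*²⇒∣ {e = e} {i = i} q-prime e*q-squarefree q∣ei²
  with prime∣*⇒∣⊎∣ {i = + e} {i ^ 2} q-prime q∣ei²
... | inj₁ q∣e  = ⊥-elim (squareFree⇒prime∤cofactor q-prime e*q-squarefree (∣⇒∣ᵤ q∣e))
... | inj₂ q∣i² = prime∣^⇒∣ q-prime 2 q∣i²

module _ (q-prime : Prime q) (q∣d : q ℕD.∣ d) (eq : A ^ 4 + + d * B ^ 2 ≡ C ^ p) where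

  private
    q∣dB² : + q ∣ + d * B ^ 2
    q∣dB² = ∣m⇒∣m*n {m = + d} (B ^ 2) (∣ᵤ⇒∣ q∣d)

  ∣A⇒∣C : + q ∣ A → + q ∣ C
  ∣A⇒∣C q∣A =
    prime∣^⇒∣ q-prime p (subst (+ q ∣_) eq (∣m∣n⇒∣m+n (∣⇒∣^ {n = 4} q∣A (s≤s z≤n)) q∣dB²))

  ∣C⇒∣A : 1 ≤ p → + q ∣ C → + q ∣ A
  ∣C⇒∣A 1≤p q∣C =
    prime∣^⇒∣ q-prime 4 (∣m+n∣n⇒∣m (subst (+ q ∣_) (sym eq) (∣⇒∣^ q∣C 1≤p)) q∣dB²)

  ∣A²Cᵖ⇒∣A×∣C : 1 ≤ p → + q ∣ A ^ 2 * C ^ p → + q ∣ A × + q ∣ C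
  ∣A²Cᵖ⇒∣A×∣C 1≤p q∣A²Cᵖ with prime∣*⇒∣⊎∣ {i = A ^ 2} q-prime q∣A²Cᵖ
  ... | inj₁ q∣A² = let q∣A = prime∣^⇒∣ q-prime 2 q∣A² in q∣A , ∣A⇒∣C q∣A
  ... | inj₂ q∣Cᵖ = let q∣C = prime∣^⇒∣ q-prime p q∣Cᵖ in ∣C⇒∣A 1≤p q∣C , q∣C

  ∣A∧∣C⇒∣B : SquareFree d → 2 ≤ p → + q ∣ A → + q ∣ C → + q ∣ B
  ∣A∧∣C⇒∣B d-squarefree 2≤p q∣A q∣C =
    prime∣cofactor*²⇒∣ {e = d/q} {i = B} q-prime (subst SquareFree d≡d/q*q d-squarefree)
      (*-cancelˡ-∣ (+ q) q²∣q·d/q·B²)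
    where
    open ℕD._∣_ q∣d renaming (quotient to d/q; equality to d≡d/q*q)
    instance _ = prime⇒nonZero q-prime

    q²∣dB² : + q * + q ∣ + d * B ^ 2
    q²∣dB² = ∣m+n∣m⇒∣n (subst (+ q * + q ∣_) (sym eq) (∣⇒²∣^ q∣C 2≤p))
                       (∣⇒²∣^ {n = 4} q∣A (s≤s (s≤s z≤n)))

    dB²≡q·d/q·B² : + d * B ^ 2 ≡ + q * (+ d/q * B ^ 2)
    dB²≡q·d/q·B² = begin
      + d * B ^ 2             ≡⟨ cong (λ n → + n * B ^ 2) d≡d/q*q ⟩
      + (d/q ℕ.* q) * B ^ 2   ≡⟨ cong (_* B ^ 2) (ℤP.pos-* d/q q) ⟩
      + d/q * + q * B ^ 2     ≡⟨ swap (+ d/q) (+ q) (B ^ 2) ⟩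
      + q * (+ d/q * B ^ 2)   ∎
      where
      open ≡-Reasoning
      swap : ∀ x y z → x * y * z ≡ y * (x * z)
      swap = solve-∀

    q²∣q·d/q·B² : + q * + q ∣ + q * (+ d/q * B ^ 2)
    q²∣q·d/q·B² = subst (+ q * + q ∣_) dB²≡q·d/q·B² q²∣dB²

primeAboveDivides[discE]⇒∣A²Cᵖ : Prime q → q % 2 ≡ 1 → q ℕD.∣ d →
  PrimeAboveDivides d q (discE p A B C) → + q ∣ A ^ 2 * C ^ p
primeAboveDivides[discE]⇒∣A²Cᵖ {q} {p = p} {A} {B} {C} q-prime q-odd q∣d 𝔮∣Δ =
  [ ⊥-elim ∘ oddPrime∤2^ q-prime q-odd 10 , id ]′
    (prime∣*⇒∣⊎∣ {i = (+ 2) ^ 10} q-prime q∣2¹⁰A²Cᵖ)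
  where
  normalise : ∀ (X Y : ℤ) → + 2 * (+ 512 * X * Y) ≡ (+ 2) ^ 10 * (X * Y)
  normalise = solve-∀

  q∣2¹⁰A²Cᵖ : + q ∣ (+ 2) ^ 10 * (A ^ 2 * C ^ p)
  q∣2¹⁰A²Cᵖ = subst (+ q ∣_) (normalise (A ^ 2) (C ^ p)) (primeAboveDivides⇒∣₁ q∣d 𝔮∣Δ)

¬prime∣common : gcd (gcd A B) C ≡ + 1 → Prime q → ¬ (+ q ∣ A × + q ∣ B × + q ∣ C)
¬prime∣common {A} {B} {C} {q} gcd≡1 q-prime (q∣A , q∣B , q∣C) =
  prime∤1 q-prime (subst (+ q ∣_) gcd≡1 q∣gcd)
  where
  q∣gcd : + q ∣ gcd (gcd A B) C
  q∣gcd = ∣ᵤ⇒∣ (gcd-greatest {gcd A B} {C} {+ q}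
                  (gcd-greatest {A} {B} {+ q} (∣⇒∣ᵤ q∣A) (∣⇒∣ᵤ q∣B)) (∣⇒∣ᵤ q∣C))

mainTheorem11 : (d p q : ℕ) → (A B C : ℤ) →
    1 ℕ.≤ d → SquareFree d → Prime p →
    (A ^ 4) + (+ d) * (B ^ 2) ≡ C ^ p →
    gcd (gcd A B) C ≡ + 1 →
    Prime q → q % 2 ≡ 1 → Ramified d q →
    ¬ PrimeAboveDivides d q (discE p A B C)
mainTheorem11 d p q A B C _ d-squarefree p-prime eq gcd≡1 q-prime q-odd q-ramified 𝔮∣Δ =
  ¬prime∣common gcd≡1 q-prime (q∣A , q∣B , q∣C)
  where
  q∣d : q ℕD.∣ d
  q∣d = oddRamified⇒∣ q-prime q-odd q-ramified

  1<p : 1 ℕ.< p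
  1<p = ℕ.nonTrivial⇒n>1 p {{prime⇒nonTrivial p-prime}}

  q∣A²Cᵖ : + q ∣ A ^ 2 * C ^ p
  q∣A²Cᵖ = primeAboveDivides[discE]⇒∣A²Cᵖ {p = p} {A = A} {B = B} {C = C}
             q-prime q-odd q∣d 𝔮∣Δ

  q∣A×q∣C : + q ∣ A × + q ∣ C
  q∣A×q∣C = ∣A²Cᵖ⇒∣A×∣C {B = B} q-prime q∣d eq (ℕP.<⇒≤ 1<p) q∣A²Cᵖ

  q∣A : + q ∣ A
  q∣A = proj₁ q∣A×q∣C

  q∣C : + q ∣ C
  q∣C = proj₂ q∣A×q∣C

  q∣B : + q ∣ B
  q∣B = ∣A∧∣C⇒∣B {A = A} {C = C} q-prime q∣d eq d-squarefree 1<p q∣A q∣C
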